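{- Let $M$ be a finite semilattice with separated equalizers. Let $p$ be an irreducible object with predecessor $q$, and let $s$ be a singular object with successor $t$, such that $q\mid s$ and $p\nmid s$. Then there is no object $x$ with $q\mid x$, $p\nmid x$, and $x$ incomparable to $s$ (i.e. $x\nmid s$ and $s\nmid x$).
   Context: A semilattice here is a commutative monoid (written multiplicatively, with identity) in which every element satisfies $x^2=x$; $x\mid y$ means $xz=y$ for some $z$. An object $p$ is irreducible if $p=yz$ implies $p=y$ or $p=z$; a predecessor of $p$ is an object $q\neq p$ with $q\mid p$ such that every $x$ with $x\mid p$ satisfies $x=p$ or $x\mid q$. An object $s$ is singular with successor $t$ if $t\neq s$, $s\mid t$, and every $x$ with $s\mid x$ satisfies $x=s$ or $t\mid x$. An equalizing pair is a pair $x,y$ with $x\mid y$ for which there exist $a,b$ with $xa\neq xb$, $xa\neq ya$, $ya=yb$, $yb\neq xb$; $M$ has separated equalizers if for each equalizing pair $x,y$ there is $z$ with $x\mid z\mid y$, $z\neq x$, $z\neq y$. -}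

module Defs where

open import Level using (Level; suc; _⊔_)
open import Data.Product using (Σ; ∃; _×_; _,_)
open import Data.List using (List)
open import Data.List.Membership.Propositional using (_∈_)
open import Relation.Binary.PropositionalEquality using (_≡_)
open import Relation.Nullary using (¬_)
open import Algebra.Structures using (IsCommutativeMonoid)
open import Algebra.Definitions using (Idempotent)

record Semilattice (c : Level) : Set (suc c) where
  infixl 7 _∙_
  field
    Carrier : Set c
    _∙_ : Carrier → Carrier → Carrier
    ε : Carrier
    isCommutativeMonoid : IsCommutativeMonoid _≡_ _∙_ ε
    idem : Idempotent _≡_ _∙_

module _ {c : Level} (M : Semilattice c) where
  open Semilattice M

  _∣_ : Carrier → Carrier → Set c
  x ∣ y = ∃ λ z → x ∙ z ≡ y

  Finite : Set c
  Finite = ∃ λ (xs : List Carrier) → ∀ x → x ∈ xs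

  Irreducible : Carrier → Set c
  Irreducible p = ∀ y z → p ≡ y ∙ z → (p ≡ y) Data.Sum.⊎ (p ≡ z)
    where import Data.Sum

  IsPredecessor : Carrier → Carrier → Set c
  IsPredecessor q p = ¬ (q ≡ p) × q ∣ p × (∀ x → x ∣ p → (x ≡ p) Data.Sum.⊎ (x ∣ q))
    where import Data.Sum

  SingularWithSuccessor : Carrier → Carrier → Set c
  SingularWithSuccessor s t = ¬ (t ≡ s) × s ∣ t × (∀ x → s ∣ x → (x ≡ s) Data.Sum.⊎ (t ∣ x))
    where import Data.Sum

  EqualizingPair : Carrier → Carrier → Set c
  EqualizingPair x y = x ∣ y × (∃ λ a → ∃ λ b →
    ¬ (x ∙ a ≡ x ∙ b) × ¬ (x ∙ a ≡ y ∙ a) × (y ∙ a ≡ y ∙ b) × ¬ (y ∙ b ≡ x ∙ b))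

  SeparatedEqualizers : Set c
  SeparatedEqualizers = ∀ x y → EqualizingPair x y →
    ∃ λ z → x ∣ z × z ∣ y × ¬ (z ≡ x) × ¬ (z ≡ y)

-- Since q is covered by p, separated equalizers force the map a ↦ p ∙ a to be
-- injective on the elements above q that are not above p. Applied to s and its successor t
-- this gives p ∣ t. An x as in the theorem then satisfies t ∣ s ∙ x, so p ∣ s ∙ x although
-- p ∤ s and p ∤ x. Such pairs cannot exist: in a minimal one (u , v) pick lower covers w of u
-- and w′ of v above q; separated equalizers give u ∙ v = p ∙ (w ∙ v) = p ∙ (w′ ∙ u), so by
-- injectivity w ∙ v = w′ ∙ u lies above u ∙ v, hence above p, against minimality.
module Submission where

open import Defs hiding (_∣_)
open import Level using (Level)
open import Function.Base using (_∘_; flip)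
open import Data.Product using (∃; _×_; _,_; proj₁; proj₂)
open import Data.Product.Relation.Binary.Pointwise.NonDependent using (Pointwise; ×-refl; ×-transitive)
open import Data.Sum using (inj₁; inj₂)
open import Data.Empty using (⊥-elim)
open import Data.List using (List; []; _∷_; cartesianProduct)
open import Data.List.Membership.Propositional using (_∈_)
open import Data.List.Membership.Propositional.Properties using (∈-cartesianProduct⁺)
open import Data.List.Relation.Unary.All using (All; []; _∷_; lookup)
open import Relation.Binary.Core using (Rel)
open import Relation.Binary.Definitions using (Reflexive; Transitive)
open import Relation.Binary.PropositionalEquality using (_≡_; refl; sym; trans; cong; subst; module ≡-Reasoning)
open import Relation.Nullary using (¬_; yes; no)
open import Relation.Nullary.Decidable using (¬¬-excluded-middle)
open import Relation.Unary using (Pred)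
open import Algebra.Bundles using (CommutativeSemigroup)
open import Algebra.Structures using (IsCommutativeMonoid)
import Algebra.Properties.CommutativeSemigroup as CommutativeSemigroupProperties

-- Without decidable equality a finite search only yields minimality up to double negation,
-- so every statement below that needs a minimal element concludes ¬ ¬ _ or ⊥.
module FiniteMinimal {a r} {A : Set a} {_≤_ : Rel A r}
  (≤-refl : Reflexive _≤_) (≤-trans : Transitive _≤_) where

  _<_ : Rel A r
  x < y = x ≤ y × ¬ y ≤ x

  <-≤-trans : ∀ {x y z} → x < y → y ≤ z → x < z
  <-≤-trans (x≤y , y≰x) y≤z = ≤-trans x≤y y≤z , λ z≤x → y≰x (≤-trans y≤z z≤x)

  Minimal : ∀ {p} → Pred A p → Pred A _
  Minimal P m = P m × ∀ {y} → P y → ¬ y < m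

  minimal-exists : ∀ {p} {P : Pred A p} (xs : List A) → (∀ x → x ∈ xs) →
                   ∀ {x} → P x → ¬ ¬ ∃ (Minimal P)
  minimal-exists {P = P} xs complete px k =
    below xs px λ (m , pm , _ , minimal) → k (m , pm , λ py y<m → lookup minimal (complete _) (py , y<m))
    where
    below : ∀ ys {x} → P x → ¬ ¬ ∃ λ m → P m × m ≤ x × All (λ y → ¬ (P y × y < m)) ys
    below []       {x} px k = k (x , px , ≤-refl , [])
    below (y ∷ ys) {x} px k = ¬¬-excluded-middle {A = P y × y < x} λ where
      (yes (py , y<x)) → below ys py λ (m , pm , m≤y , minimal) →
        k (m , pm , ≤-trans m≤y (proj₁ y<x) , (λ (_ , _ , m≰y) → m≰y m≤y) ∷ minimal)
      (no ¬py<x) → below ys px λ (m , pm , m≤x , minimal) →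
        k (m , pm , m≤x , (λ (py , y<m) → ¬py<x (py , <-≤-trans y<m m≤x)) ∷ minimal)

module Properties {c} (M : Semilattice c) where
  open Semilattice M
  open IsCommutativeMonoid isCommutativeMonoid using (assoc; comm; isCommutativeSemigroup)

  infix 4 _∣_ _⋖_

  private
    commutativeSemigroup : CommutativeSemigroup c c
    commutativeSemigroup = record { isCommutativeSemigroup = isCommutativeSemigroup }

    _∣_ : Rel Carrier c
    _∣_ = Defs._∣_ M

    variable
      a b p q s t u v w x y z : Carrier

  open CommutativeSemigroupProperties commutativeSemigroup using (x∙yz≈y∙xz)

  ∙≡⇒∣ : x ∙ y ≡ y → x ∣ y
  ∙≡⇒∣ e = _ , e

  ∣⇒∙≡ : x ∣ y → x ∙ y ≡ y
  ∣⇒∙≡ {x} (z , refl) = trans (sym (assoc x x z)) (cong (_∙ z) (idem x))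

  ∣-refl : x ∣ x
  ∣-refl = ∙≡⇒∣ (idem _)

  ∣-trans : x ∣ y → y ∣ z → x ∣ z
  ∣-trans {x} (a , refl) (b , refl) = a ∙ b , sym (assoc x a b)

  ∣-antisym : x ∣ y → y ∣ x → x ≡ y
  ∣-antisym {x} {y} x∣y y∣x = trans (sym (∣⇒∙≡ y∣x)) (trans (comm y x) (∣⇒∙≡ x∣y))

  x∣x∙y : x ∣ x ∙ y
  x∣x∙y = _ , refl

  y∣x∙y : y ∣ x ∙ y
  y∣x∙y {y} {x} = x , comm y x

  ∙-lub : x ∣ z → y ∣ z → x ∙ y ∣ z
  ∙-lub {x} {z} {y} x∣z y∣z = ∙≡⇒∣ (trans (assoc x y z) (trans (cong (x ∙_) (∣⇒∙≡ y∣z)) (∣⇒∙≡ x∣z)))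

  record _⋖_ (x y : Carrier) : Set c where
    field
      divides         : x ∣ y
      distinct        : ¬ x ≡ y
      nothing-between : ¬ ∃ λ z → x ∣ z × z ∣ y × ¬ z ≡ x × ¬ z ≡ y

  open _⋖_

  predecessor⇒⋖ : IsPredecessor M x y → x ⋖ y
  predecessor⇒⋖ (_   , x∣y , _) .divides  = x∣y
  predecessor⇒⋖ (x≢y , _   , _) .distinct = x≢y
  predecessor⇒⋖ (x≢y , x∣y , below) .nothing-between (z , x∣z , z∣y , z≢x , z≢y) with below z z∣y
  ... | inj₁ z≡y = z≢y z≡y
  ... | inj₂ z∣x = z≢x (∣-antisym z∣x x∣z)

  ⋖-below : Finite M → x ∣ y → ¬ x ≡ y → ¬ ¬ ∃ λ w → x ∣ w × w ⋖ y
  ⋖-below {x} {y} (xs , complete) x∣y x≢y k =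
    minimal-exists {P = λ w → x ∣ w × w ∣ y × ¬ w ≡ y} xs complete (∣-refl , x∣y , x≢y)
      λ (w , (x∣w , w∣y , w≢y) , maximal) → k (w , x∣w , record
        { divides         = w∣y
        ; distinct        = w≢y
        ; nothing-between = λ (z , w∣z , z∣y , z≢w , z≢y) →
            maximal (∣-trans x∣w w∣z , z∣y , z≢y) (w∣z , λ z∣w → z≢w (∣-antisym z∣w w∣z))
        })
    where open FiniteMinimal {_≤_ = flip _∣_} ∣-refl (flip ∣-trans)

  successor∣s∙x : SingularWithSuccessor M s t → ¬ x ∣ s → t ∣ s ∙ x
  successor∣s∙x {s} {t} {x} (_ , _ , above-s) x∤s with above-s (s ∙ x) x∣x∙y
  ... | inj₁ sx≡s = ⊥-elim (x∤s (s , trans (comm x s) sx≡s))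
  ... | inj₂ t∣sx = t∣sx

  module _ (sep : SeparatedEqualizers M) where

    ⋖⇒¬equalizing : x ⋖ y → ¬ EqualizingPair M x y
    ⋖⇒¬equalizing x⋖y = nothing-between x⋖y ∘ sep _ _

    ⋖-∙-injective : x ⋖ y → x ∣ a → x ∣ b → ¬ y ∣ a → ¬ y ∣ b → y ∙ a ≡ y ∙ b → ¬ ¬ a ≡ b
    ⋖-∙-injective {x} {y} {a} {b} x⋖y x∣a x∣b y∤a y∤b ya≡yb a≢b =
      ⋖⇒¬equalizing x⋖y (divides x⋖y , _ , _ , xa≢xb , separated x∣a y∤a , ya≡yb , separated x∣b y∤b ∘ sym)
      where
      separated : ∀ {c} → x ∣ c → ¬ y ∣ c → ¬ x ∙ c ≡ y ∙ c
      separated x∣c y∤c xc≡yc = y∤c (∙≡⇒∣ (trans (sym xc≡yc) (∣⇒∙≡ x∣c)))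

      xa≢xb : ¬ x ∙ a ≡ x ∙ b
      xa≢xb xa≡xb = a≢b (trans (sym (∣⇒∙≡ x∣a)) (trans xa≡xb (∣⇒∙≡ x∣b)))

    -- The equalizing pair used is a = v, b = p ∙ v, which u equalizes because p ∣ u ∙ v.
    ⋖-∙-step : w ⋖ u → p ∣ u ∙ v → ¬ p ∣ w ∙ v → ¬ ¬ u ∙ v ≡ p ∙ (w ∙ v)
    ⋖-∙-step {w} {u} {p} {v} w⋖u p∣uv p∤wv uv≢p∙wv =
      ⋖⇒¬equalizing w⋖u (divides w⋖u , v , p ∙ v , wv≢w∙pv , wv≢uv , uv≡u∙pv , u∙pv≢w∙pv)
      where
      uv≡u∙pv : u ∙ v ≡ u ∙ (p ∙ v)
      uv≡u∙pv = sym (trans (x∙yz≈y∙xz u p v) (∣⇒∙≡ p∣uv))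

      wv≢w∙pv : ¬ w ∙ v ≡ w ∙ (p ∙ v)
      wv≢w∙pv e = p∤wv (∙≡⇒∣ (trans (x∙yz≈y∙xz p w v) (sym e)))

      wv≢uv : ¬ w ∙ v ≡ u ∙ v
      wv≢uv e = p∤wv (subst (p ∣_) (sym e) p∣uv)

      u∙pv≢w∙pv : ¬ u ∙ (p ∙ v) ≡ w ∙ (p ∙ v)
      u∙pv≢w∙pv e = uv≢p∙wv (begin
        u ∙ v       ≡⟨ uv≡u∙pv ⟩
        u ∙ (p ∙ v) ≡⟨ e ⟩
        w ∙ (p ∙ v) ≡⟨ x∙yz≈y∙xz w p v ⟩
        p ∙ (w ∙ v) ∎)
        where open ≡-Reasoning

    p∣successor : q ⋖ p → SingularWithSuccessor M s t → q ∣ s → ¬ p ∣ s → ¬ ¬ p ∣ t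
    p∣successor {q} {p} {s} {t} q⋖p (t≢s , s∣t , above-s) q∣s p∤s p∤t with above-s (p ∙ s) y∣x∙y
    ... | inj₁ ps≡s = p∤s (∙≡⇒∣ ps≡s)
    ... | inj₂ t∣ps = ⋖-∙-injective q⋖p q∣s (∣-trans q∣s s∣t) p∤s p∤t ps≡pt (t≢s ∘ sym)
      where
      ps≡pt : p ∙ s ≡ p ∙ t
      ps≡pt = ∣-antisym (∙-lub x∣x∙y (∣-trans s∣t y∣x∙y)) (∙-lub x∣x∙y t∣ps)

    module _ (fin : Finite M) (q⋖p : q ⋖ p) where

      BadPair : Pred (Carrier × Carrier) c
      BadPair (u , v) = q ∣ u × q ∣ v × ¬ p ∣ u × ¬ p ∣ v × p ∣ u ∙ v

      open FiniteMinimal {_≤_ = Pointwise _∣_ _∣_}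
        (×-refl {R = _∣_} {S = _∣_} ∣-refl ∣-refl) (×-transitive {R = _∣_} {S = _∣_} ∣-trans ∣-trans)

      no-minimal-BadPair : ∀ {uv} → ¬ Minimal BadPair uv
      no-minimal-BadPair {u , v} ((q∣u , q∣v , p∤u , p∤v , p∣uv) , minimal) =
        ⋖-below fin q∣u (q≢ q∣v p∤v p∣uv) λ (w , q∣w , w⋖u) →
        ⋖-below fin q∣v (q≢ q∣u p∤u p∣vu) λ (w′ , q∣w′ , w′⋖v) →
        let p∤wv = p∤∙v q∣w w⋖u ; p∤w′u = p∤∙u q∣w′ w′⋖v in
        ⋖-∙-step w⋖u p∣uv p∤wv λ uv≡p∙wv →
        ⋖-∙-step w′⋖v p∣vu p∤w′u λ vu≡p∙w′u →
        ⋖-∙-injective q⋖p (∣-trans q∣w x∣x∙y) (∣-trans q∣w′ x∣x∙y) p∤wv p∤w′u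
          (trans (sym uv≡p∙wv) (trans (comm u v) vu≡p∙w′u)) λ wv≡w′u →
        p∤wv (∣-trans p∣uv (∙-lub (subst (u ∣_) (sym wv≡w′u) y∣x∙y) y∣x∙y))
        where
        p∣vu : p ∣ v ∙ u
        p∣vu = subst (p ∣_) (comm u v) p∣uv

        q≢ : ∀ {x y} → q ∣ y → ¬ p ∣ y → p ∣ x ∙ y → ¬ q ≡ x
        q≢ q∣y p∤y p∣qy refl = p∤y (subst (p ∣_) (∣⇒∙≡ q∣y) p∣qy)

        strictly : ∀ {x y} → x ⋖ y → ¬ y ∣ x
        strictly x⋖y y∣x = distinct x⋖y (∣-antisym (divides x⋖y) y∣x)

        p∤∙v : ∀ {w} → q ∣ w → w ⋖ u → ¬ p ∣ w ∙ v
        p∤∙v q∣w w⋖u p∣wv = minimal (q∣w , q∣v , p∤u ∘ flip ∣-trans (divides w⋖u) , p∤v , p∣wv)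
                                    ((divides w⋖u , ∣-refl) , strictly w⋖u ∘ proj₁)

        p∤∙u : ∀ {w} → q ∣ w → w ⋖ v → ¬ p ∣ w ∙ u
        p∤∙u {w} q∣w w⋖v p∣wu =
          minimal (q∣u , q∣w , p∤u , p∤v ∘ flip ∣-trans (divides w⋖v) , subst (p ∣_) (comm w u) p∣wu)
                  ((∣-refl , divides w⋖v) , strictly w⋖v ∘ proj₂)

      ∤-∙-closed : q ∣ u → q ∣ v → ¬ p ∣ u → ¬ p ∣ v → ¬ p ∣ u ∙ v
      ∤-∙-closed q∣u q∣v p∤u p∤v p∣uv =
        minimal-exists (cartesianProduct xs xs) (λ (u , v) → ∈-cartesianProduct⁺ (complete u) (complete v))
          (q∣u , q∣v , p∤u , p∤v , p∣uv) (no-minimal-BadPair ∘ proj₂)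
        where
        xs : List Carrier
        xs = proj₁ fin

        complete : ∀ x → x ∈ xs
        complete = proj₂ fin

open Defs using (_∣_)

mainTheorem14 : ∀ {c : Level} (M : Semilattice c) → Finite M → SeparatedEqualizers M →
    (p q s t : Semilattice.Carrier M) →
    Irreducible M p → IsPredecessor M q p → SingularWithSuccessor M s t →
    _∣_ M q s → ¬ (_∣_ M p s) →
    ¬ (∃ λ x → _∣_ M q x × ¬ (_∣_ M p x) × ¬ (_∣_ M x s) × ¬ (_∣_ M s x))
mainTheorem14 M fin sep p q s t _ pred sing q∣s p∤s (x , q∣x , p∤x , x∤s , _) =
  p∣successor sep q⋖p sing q∣s p∤s λ p∣t →
  ∤-∙-closed sep fin q⋖p q∣s q∣x p∤s p∤x (∣-trans p∣t (successor∣s∙x sing x∤s))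
  where
  open Properties M
  q⋖p : q ⋖ p
  q⋖p = predecessor⇒⋖ pred
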